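{- Let $\mathcal{A}$ be a finite totally ordered alphabet. If $w \in \mathcal{A}^{+}$ is a Lyndon word, then $\mathcal{L}(w) \geq \lceil \log_{\phi}|w| \rceil + 1$, where $\phi = (1+\sqrt{5})/2$, with equality if $w$ is a Fibonacci Lyndon word.
   Context: Words are compared lexicographically ($u<v$ iff $u$ is a proper prefix of $v$ or $u=x\mathtt{a}u'$, $v=x\mathtt{b}v'$ with letters $\mathtt{a}<\mathtt{b}$). A Lyndon word is a nonempty primitive word strictly smallest in its conjugacy class. $\mathcal{L}(w)$ is the number of distinct Lyndon factors of $w$. Fibonacci numbers: $F_0=0,F_1=1,F_n=F_{n-1}+F_{n-2}$. For letters $\mathtt{a}<\mathtt{b}$ of $\mathcal{A}$, let $f_1=\mathtt{b}$, $f_2=\mathtt{a}$, $f_n=f_{n-1}f_{n-2}$, and for $n\ge3$ let $p_n$ be $f_n$ with its last two letters removed; with $c$ the morphism swapping $\mathtt{a},\mathtt{b}$, the Fibonacci Lyndon words (of length $F_n$, $n\ge 3$) over $\{\mathtt{a},\mathtt{b}\}$ are $\mathtt{a}p_n\mathtt{b}$ and $\mathtt{a}c(p_n)\mathtt{b}$. -}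

module Defs where

open import Data.Nat using (ℕ; zero; suc; _+_; _*_; _∸_; _^_; _≤_; _<_)
open import Data.Fin using (Fin) renaming (_<_ to _<ᶠ_)
open import Data.Fin.Properties using (_≟_)
open import Data.List using (List; []; _∷_; _++_; length; take; drop; map; replicate; concat)
open import Data.List.Relation.Binary.Lex.Strict using (Lex-<)
open import Data.List.Relation.Unary.Unique.Propositional using (Unique)
open import Data.List.Membership.Propositional using (_∈_)
open import Data.Product using (Σ; ∃; _×_; _,_)
open import Data.Sum using (_⊎_)
open import Data.Empty using (⊥)
open import Relation.Nullary using (¬_; yes; no)
open import Relation.Binary.PropositionalEquality using (_≡_)

Word : ℕ → Set
Word m = List (Fin m)

-- Lexicographic order as in the paper (proper prefix is smaller).
_<ˡ_ : ∀ {m} → Word m → Word m → Set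
_<ˡ_ = Lex-< _≡_ _<ᶠ_

rot : ∀ {m} → ℕ → Word m → Word m
rot i w = drop i w ++ take i w

Primitive : ∀ {m} → Word m → Set
Primitive {m} w = ∀ (u : Word m) (k : ℕ) → 2 ≤ k → ¬ (w ≡ concat (replicate k u))

Lyndon : ∀ {m} → Word m → Set
Lyndon w = (1 ≤ length w) × Primitive w
         × (∀ i → 1 ≤ i → i < length w → w <ˡ rot i w)

Factor : ∀ {m} → Word m → Word m → Set
Factor {m} u w = Σ (Word m) λ x → Σ (Word m) λ y → w ≡ x ++ u ++ y

NumLyndonFactors : ∀ {m} → Word m → ℕ → Set
NumLyndonFactors {m} w N =
  Σ (List (Word m)) λ xs → Unique xs × length xs ≡ N
    × (∀ u → (u ∈ xs → Factor u w × Lyndon u) × (Factor u w × Lyndon u → u ∈ xs))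

fib : ℕ → ℕ
fib 0 = 0
fib 1 = 1
fib (suc (suc n)) = fib (suc n) + fib n

lucas : ℕ → ℕ
lucas 0 = 2
lucas 1 = 1
lucas (suc (suc n)) = lucas (suc n) + lucas n

-- φ^k ≥ n, decided exactly: φ^k = (L_k + F_k √5)/2, so φ^k ≥ n iff
-- F_k √5 ≥ 2n - L_k, iff (2n ∸ L_k)^2 ≤ 5 F_k^2.
PhiPowGe : ℕ → ℕ → Set
PhiPowGe k n = (2 * n ∸ lucas k) ^ 2 ≤ 5 * fib k ^ 2

IsCeilLogPhi : ℕ → ℕ → Set
IsCeilLogPhi n k = PhiPowGe k n × (∀ j → j < k → ¬ PhiPowGe j n)

fibWord : ∀ {m} → Fin m → Fin m → ℕ → Word m
fibWord a b 0 = []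
fibWord a b 1 = b ∷ []
fibWord a b 2 = a ∷ []
fibWord a b (suc (suc n)) = fibWord a b (suc n) ++ fibWord a b n

pWord : ∀ {m} → Fin m → Fin m → ℕ → Word m
pWord a b n = take (length (fibWord a b n) ∸ 2) (fibWord a b n)

swapAB : ∀ {m} → Fin m → Fin m → Fin m → Fin m
swapAB a b x with x ≟ a
... | yes _ = b
... | no _ with x ≟ b
...   | yes _ = a
...   | no _ = x

IsFibLyndon : ∀ {m} → Word m → Set
IsFibLyndon {m} w = Σ (Fin m) λ a → Σ (Fin m) λ b → a <ᶠ b × Σ ℕ λ n → 3 ≤ n ×
  ((w ≡ a ∷ pWord a b n ++ b ∷ []) ⊎ (w ≡ a ∷ map (swapAB a b) (pWord a b n) ++ b ∷ []))

-- A Lyndon word w of length ≥ 2 factors as w = u v with v its least proper suffix, and then u and v are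
-- shorter Lyndon words. The words w, u, v are distinct Lyndon factors of w and one of u, v is not a factor
-- of the other, so from any list covering the Lyndon factors of w one can remove w and then one of u, v
-- and still cover the Lyndon factors of u and of v with strictly shorter lists. By induction |w| ≤ F_N
-- when w has N Lyndon factors, and φ^(N-1) ≥ F_N gives ⌈log_φ |w|⌉ ≤ N - 1.
--
-- For equality, the morphisms α : a ↦ a, b ↦ ab and β : a ↦ ab, b ↦ b map the two binary Fibonacci
-- Lyndon words of length F_(k+3) to those of length F_(k+4). A binary Lyndon word of length ≥ 2 starts
-- with a and ends with b, so such a Lyndon factor of an image is the image of a factor, itself Lyndon as
-- the morphisms reflect the lexicographic order. Each step thus adds only one Lyndon factor, a single
-- letter: the words of length F_(k+3) have at most k + 3 Lyndon factors, while φ^(k+1) < F_(k+3).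

module Submission where

open import Data.Empty using (⊥-elim)
open import Data.Fin using (Fin; zero; suc) renaming (_<_ to _<ᶠ_)
import Data.Fin.Properties as Fin
open import Data.List
  using (List; []; _∷_; _++_; length; take; drop; map; replicate; concat; concatMap; filter; _∷ʳ′_; initLast)
open import Data.List.Membership.Propositional using (_∈_)
open import Data.List.Membership.Propositional.Properties using (∈-map⁺; ∈-filter⁺; ∈-++⁺ˡ; ∈-++⁺ʳ)
open import Data.List.Properties
  using (++-assoc; ++-identityʳ; ++-conicalˡ; ++-conicalʳ; ∷-injectiveˡ; ∷-injectiveʳ; ≡-dec;
         length-++; length-++-comm; length-++-≤ˡ; length-++-≤ʳ; length-map; length-drop;
         take++drop≡id; take-map; map-++; map-∘; map-cong; concat-++; filter-notAll)
open import Data.List.Relation.Binary.Lex.Core using (base; halt; this; next)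
import Data.List.Relation.Binary.Lex.Strict as Lex
open import Data.List.Relation.Binary.Pointwise using (Pointwise-≡⇒≡; ≡⇒Pointwise-≡)
open import Data.List.Relation.Unary.All using (lookup)
open import Data.List.Relation.Unary.AllPairs using ([]; _∷_)
import Data.List.Relation.Unary.Any as Any
open import Data.List.Relation.Unary.Any using (here; there)
open import Data.List.Relation.Unary.Unique.Propositional using (Unique)
open import Data.Nat
  using (ℕ; zero; suc; _+_; _*_; _∸_; _^_; _≤_; _<_; _≤′_; ≤′-refl; ≤′-step; z≤n; s≤s; _≤?_)
open import Data.Nat.Induction using (<-wellFounded)
open import Data.Nat.Properties
  using (≤-refl; ≤-trans; ≤-antisym; <-irrefl; ≤-<-trans; ≰⇒>; ≤⇒≯; ≤⇒≤′; <⇒≤; suc-injective;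
         +-comm; +-assoc; +-commutativeSemigroup; +-mono-≤; +-monoʳ-≤; +-cancelˡ-≡; m≤m+n; m<m+n; m<n+m;
         m+n∸m≡n; m+n∸n≡m; m<n⇒0<n∸m; ∸-monoʳ-<; ∸-monoˡ-≤;
         *-monoʳ-≤; *-distribˡ-+; m≤n*m; ^-monoˡ-≤; module ≤-Reasoning)
open import Data.Nat.Tactic.RingSolver using (solve-∀)
open import Algebra.Properties.CommutativeSemigroup +-commutativeSemigroup using (interchange)
open import Data.Product using (∃; ∃₂; _×_; _,_; proj₁; proj₂)
open import Data.Sum using (_⊎_; inj₁; inj₂; [_,_])
open import Function using (_∘_)
open import Induction.WellFounded using (Acc; acc)
open import Relation.Binary.Definitions using (Trichotomous; tri<; tri≈; tri>)
open import Relation.Binary.PropositionalEquality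
  using (_≡_; _≢_; refl; sym; trans; cong; cong₂; subst; isEquivalence; module ≡-Reasoning)
open import Relation.Nullary using (¬_; Dec; yes; no; ¬?; contradiction)
open import Relation.Nullary.Decidable using (decidable-stable; ¬¬-excluded-middle)

open import Defs

private variable
  m n j k N : ℕ
  a b c d : Fin m
  u v w x y z s t : Word m
  xs ys : List (Word m)

<ˡ-irrefl : ¬ (u <ˡ u)
<ˡ-irrefl = Lex.<-irreflexive Fin.<-irrefl (≡⇒Pointwise-≡ refl)

<ˡ-asym : u <ˡ v → ¬ (v <ˡ u)
<ˡ-asym = Lex.<-asymmetric sym Fin.<-resp₂-≡ Fin.<-asym

<ˡ-trans : u <ˡ v → v <ˡ w → u <ˡ w
<ˡ-trans = Lex.<-transitive isEquivalence Fin.<-resp₂-≡ Fin.<-trans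

<ˡ-cmp : Trichotomous _≡_ (_<ˡ_ {m})
<ˡ-cmp u v with Lex.<-compare sym Fin.<-cmp u v
... | tri< u<v u≢v v≮u = tri< u<v (u≢v ∘ ≡⇒Pointwise-≡) v≮u
... | tri≈ u≮v u≈v v≮u = tri≈ u≮v (Pointwise-≡⇒≡ u≈v) v≮u
... | tri> u≮v u≢v v<u = tri> u≮v (u≢v ∘ ≡⇒Pointwise-≡) v<u

++-monoʳ-<ˡ : ∀ (p : Word m) → u <ˡ v → (p ++ u) <ˡ (p ++ v)
++-monoʳ-<ˡ []      u<v = u<v
++-monoʳ-<ˡ (_ ∷ p) u<v = next refl (++-monoʳ-<ˡ p u<v)

++-cancelˡ-<ˡ : ∀ (p : Word m) → (p ++ u) <ˡ (p ++ v) → u <ˡ v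
++-cancelˡ-<ˡ []      u<v        = u<v
++-cancelˡ-<ˡ (_ ∷ p) (this c<c) = ⊥-elim (Fin.<-irrefl refl c<c)
++-cancelˡ-<ˡ (_ ∷ p) (next _ q) = ++-cancelˡ-<ˡ p q

u++t≮ˡu : ∀ (u t : Word m) → ¬ ((u ++ t) <ˡ u)
u++t≮ˡu []      t q          = Lex.xs≮[] q
u++t≮ˡu (_ ∷ u) t (this c<c) = Fin.<-irrefl refl c<c
u++t≮ˡu (_ ∷ u) t (next _ q) = u++t≮ˡu u t q

<ˡ-prefix⊎mismatch : u <ˡ v → (∃ λ t → v ≡ u ++ t) ⊎ (∀ c d → (u ++ c) <ˡ (v ++ d))
<ˡ-prefix⊎mismatch (base ())
<ˡ-prefix⊎mismatch (halt {y} {ys}) = inj₁ (y ∷ ys , refl)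
<ˡ-prefix⊎mismatch (this c<d)      = inj₂ λ _ _ → this c<d
<ˡ-prefix⊎mismatch (next refl u<v) with <ˡ-prefix⊎mismatch u<v
... | inj₁ (t , refl) = inj₁ (t , refl)
... | inj₂ mismatch   = inj₂ λ c d → next refl (mismatch c d)

<ˡ-++-equalLength : length u ≡ length v → u <ˡ v → (u ++ s) <ˡ (v ++ t)
<ˡ-++-equalLength ()     halt
<ˡ-++-equalLength _      (this c<d)      = this c<d
<ˡ-++-equalLength |u|≡|v| (next refl u<v) = next refl (<ˡ-++-equalLength (suc-injective |u|≡|v|) u<v)

≢[]⇒1≤length : u ≢ [] → 1 ≤ length u
≢[]⇒1≤length {u = []}    u≢[] = ⊥-elim (u≢[] refl)
≢[]⇒1≤length {u = _ ∷ _} _    = s≤s z≤n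

1≤length⇒≢[] : 1 ≤ length u → u ≢ []
1≤length⇒≢[] {u = _ ∷ _} _ ()

length-<-++ˡ : ∀ (u : Word m) → v ≢ [] → length u < length (u ++ v)
length-<-++ˡ u v≢[] = subst (length u <_) (sym (length-++ u)) (m<m+n (length u) (≢[]⇒1≤length v≢[]))

length-<-++ʳ : u ≢ [] → length v < length (u ++ v)
length-<-++ʳ {u = u} {v = v} u≢[] = subst (length v <_) (sym (length-++ u)) (m<n+m (length v) (≢[]⇒1≤length u≢[]))

s≢x++s : x ≢ [] → s ≢ x ++ s
s≢x++s x≢[] s≡xs = <-irrefl (cong length s≡xs) (length-<-++ʳ x≢[])

take-length-++ : ∀ (x s : Word m) → take (length x) (x ++ s) ≡ x
take-length-++ []      s = refl
take-length-++ (c ∷ x) s = cong (c ∷_) (take-length-++ x s)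

drop-length-++ : ∀ (x s : Word m) → drop (length x) (x ++ s) ≡ s
drop-length-++ []      s = refl
drop-length-++ (c ∷ x) s = drop-length-++ x s

take-≢[] : ∀ i → 1 ≤ i → w ≢ [] → take i w ≢ []
take-≢[] {w = []}    _       _ w≢[] _  = w≢[] refl
take-≢[] {w = _ ∷ _} (suc i) _ _    ()

drop-≢[] : ∀ i → i < length w → drop i w ≢ []
drop-≢[] {w = w} i i<|w| = 1≤length⇒≢[] (subst (0 <_) (sym (length-drop i w)) (m<n⇒0<n∸m i<|w|))

rot-length-++ : ∀ (x s : Word m) → rot (length x) (x ++ s) ≡ s ++ x
rot-length-++ x s = cong₂ _++_ (drop-length-++ x s) (take-length-++ x s)

SmallerThanSuffixes : Word m → Set
SmallerThanSuffixes w = w ≢ [] × (∀ x s → x ≢ [] → s ≢ [] → w ≡ x ++ s → w <ˡ s)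

Lyndon⇒SmallerThanSuffixes : Lyndon w → SmallerThanSuffixes w
Lyndon⇒SmallerThanSuffixes {w = w} (1≤|w| , _ , smallerThanRotations) = 1≤length⇒≢[] 1≤|w| , smaller
  where
  smallerThanConjugate : ∀ x s → x ≢ [] → s ≢ [] → w ≡ x ++ s → w <ˡ (s ++ x)
  smallerThanConjugate x s x≢[] s≢[] refl =
    subst ((x ++ s) <ˡ_) (rot-length-++ x s)
      (smallerThanRotations (length x) (≢[]⇒1≤length x≢[]) (length-<-++ˡ x s≢[]))

  smaller : ∀ x s → x ≢ [] → s ≢ [] → w ≡ x ++ s → w <ˡ s
  smaller x s x≢[] s≢[] w≡xs with <ˡ-cmp w s
  ... | tri< w<s _ _  = w<s
  ... | tri≈ _ w≡s _  = ⊥-elim (s≢x++s x≢[] (trans (sym w≡s) w≡xs))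
  ... | tri> _ _ s<w with <ˡ-prefix⊎mismatch s<w
  ...   | inj₂ mismatch =
    ⊥-elim (<ˡ-asym (smallerThanConjugate x s x≢[] s≢[] w≡xs) (subst ((s ++ x) <ˡ_) (++-identityʳ w) (mismatch x [])))
  ...   | inj₁ (t , w≡st) = ⊥-elim (<ˡ-asym xs<ts (<ˡ-++-equalLength |t|≡|x| t<x))
    where
    |t|≡|x| : length t ≡ length x
    |t|≡|x| = +-cancelˡ-≡ (length s) _ _ (begin
      length s + length t  ≡⟨ sym (length-++ s) ⟩
      length (s ++ t)      ≡⟨ cong length (trans (sym w≡st) w≡xs) ⟩
      length (x ++ s)      ≡⟨ length-++-comm x s ⟩
      length (s ++ x)      ≡⟨ length-++ s ⟩
      length s + length x  ∎)
      where open ≡-Reasoning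
    t<x : t <ˡ x
    t<x = ++-cancelˡ-<ˡ s (subst (_<ˡ (s ++ x)) w≡st (smallerThanConjugate x s x≢[] s≢[] w≡xs))
    t≢[] : t ≢ []
    t≢[] = 1≤length⇒≢[] (subst (1 ≤_) (sym |t|≡|x|) (≢[]⇒1≤length x≢[]))
    xs<ts : (x ++ s) <ˡ (t ++ s)
    xs<ts = subst (_<ˡ (t ++ s)) w≡xs (smallerThanConjugate s t s≢[] t≢[] w≡st)

concat-replicate-comm : ∀ (u : Word m) n → u ++ concat (replicate n u) ≡ concat (replicate n u) ++ u
concat-replicate-comm u zero    = ++-identityʳ u
concat-replicate-comm u (suc n) = trans (cong (u ++_) (concat-replicate-comm u n)) (sym (++-assoc u _ u))

concat-replicate-[] : ∀ n → concat (replicate n []) ≡ ([] {A = Fin m})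
concat-replicate-[] zero    = refl
concat-replicate-[] (suc n) = concat-replicate-[] n

SmallerThanSuffixes⇒Lyndon : SmallerThanSuffixes w → Lyndon w
SmallerThanSuffixes⇒Lyndon {w = w} (w≢[] , smaller) = ≢[]⇒1≤length w≢[] , isPrimitive , smallerThanRotations
  where
  isPrimitive : Primitive w
  isPrimitive _       1             (s≤s ()) _
  isPrimitive []      (suc (suc k)) _ w≡uᵏ = w≢[] (trans w≡uᵏ (concat-replicate-[] k))
  isPrimitive (c ∷ u) (suc (suc k)) _ w≡uᵏ =
    u++t≮ˡu uᵏ⁺¹ (c ∷ u) (subst (_<ˡ uᵏ⁺¹) (trans w≡uᵏ (concat-replicate-comm (c ∷ u) (suc k)))
                                   (smaller (c ∷ u) uᵏ⁺¹ (λ ()) (λ ()) w≡uᵏ))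
    where
    uᵏ⁺¹ : Word _
    uᵏ⁺¹ = concat (replicate (suc k) (c ∷ u))

  smallerThanRotations : ∀ i → 1 ≤ i → i < length w → w <ˡ rot i w
  smallerThanRotations i 1≤i i<|w|
    with <ˡ-prefix⊎mismatch (smaller (take i w) (drop i w) (take-≢[] i 1≤i w≢[]) (drop-≢[] i i<|w|) (sym (take++drop≡id i w)))
  ... | inj₂ mismatch = subst (_<ˡ rot i w) (++-identityʳ w) (mismatch [] (take i w))
  ... | inj₁ (t , drop≡wt) = ⊥-elim (<-irrefl refl (begin-strict
      length (drop i w)  ≡⟨ length-drop i w ⟩
      length w ∸ i       <⟨ ∸-monoʳ-< 1≤i (<⇒≤ i<|w|) ⟩
      length w           ≤⟨ length-++-≤ˡ w ⟩
      length (w ++ t)    ≡⟨ cong length (sym drop≡wt) ⟩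
      length (drop i w)  ∎))
    where open ≤-Reasoning

-- Standard factorisation

Suffix : Word m → Word m → Set
Suffix {m} s w = ∃ λ (p : Word m) → w ≡ p ++ s

_≤ˡ_ : Word m → Word m → Set
u ≤ˡ v = u <ˡ v ⊎ u ≡ v

<ˡ-≤ˡ-trans : u <ˡ v → v ≤ˡ w → u <ˡ w
<ˡ-≤ˡ-trans u<v (inj₁ v<w) = <ˡ-trans u<v v<w
<ˡ-≤ˡ-trans u<v (inj₂ refl) = u<v

suffix-∷ : Suffix s (c ∷ w) → s ≡ c ∷ w ⊎ Suffix s w
suffix-∷ ([]    , refl) = inj₁ refl
suffix-∷ (_ ∷ p , refl) = inj₂ (p , refl)

suffix-tail : c ∷ w ≡ x ++ s → x ≢ [] → Suffix s w
suffix-tail {x = []}    _    x≢[] = ⊥-elim (x≢[] refl)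
suffix-tail {x = _ ∷ x} refl _    = x , refl

record LeastSuffix (w : Word m) : Set where
  constructor leastSuffix
  field
    suffix    : Word m
    nonempty  : suffix ≢ []
    isSuffix  : Suffix suffix w
    least     : ∀ s → s ≢ [] → Suffix s w → suffix ≤ˡ s

wholeLeastSuffix : (∀ s → s ≢ [] → Suffix s w → (c ∷ w) <ˡ s) → LeastSuffix (c ∷ w)
wholeLeastSuffix {w = w} {c = c} smaller = leastSuffix (c ∷ w) (λ ()) ([] , refl) least
  where
  least : ∀ s → s ≢ [] → Suffix s (c ∷ w) → (c ∷ w) ≤ˡ s
  least s s≢[] s⊒cw with suffix-∷ s⊒cw
  ... | inj₁ refl = inj₂ refl
  ... | inj₂ s⊒w  = inj₁ (smaller s s≢[] s⊒w)

extendLeastSuffix : (ls : LeastSuffix w) → LeastSuffix.suffix ls ≤ˡ (c ∷ w) → LeastSuffix (c ∷ w)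
extendLeastSuffix {w = w} {c = c} (leastSuffix v v≢[] (p , w≡pv) leastᵛ) v≤cw =
  leastSuffix v v≢[] (c ∷ p , cong (c ∷_) w≡pv) least
  where
  least : ∀ s → s ≢ [] → Suffix s (c ∷ w) → v ≤ˡ s
  least s s≢[] s⊒cw with suffix-∷ s⊒cw
  ... | inj₁ refl = v≤cw
  ... | inj₂ s⊒w  = leastᵛ s s≢[] s⊒w

findLeastSuffix : ∀ (w : Word m) → w ≢ [] → LeastSuffix w
findLeastSuffix []       w≢[] = ⊥-elim (w≢[] refl)
findLeastSuffix (c ∷ []) _    = wholeLeastSuffix λ s s≢[] (p , []≡ps) → ⊥-elim (s≢[] (++-conicalʳ p s (sym []≡ps)))
findLeastSuffix (c ∷ w@(_ ∷ _)) _ with ls ← findLeastSuffix w (λ ()) | <ˡ-cmp (c ∷ w) (LeastSuffix.suffix ls)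
... | tri< cw<v _ _ = wholeLeastSuffix λ s s≢[] s⊒w → <ˡ-≤ˡ-trans cw<v (LeastSuffix.least ls s s≢[] s⊒w)
... | tri≈ _ cw≡v _ = extendLeastSuffix ls (inj₂ (sym cw≡v))
... | tri> _ _ v<cw = extendLeastSuffix ls (inj₁ v<cw)

-- w = u v with v the least proper suffix of w.
standardFactorisation : SmallerThanSuffixes w → 2 ≤ length w →
  ∃₂ λ u v → w ≡ u ++ v × SmallerThanSuffixes u × SmallerThanSuffixes v
standardFactorisation {w = _ ∷ []} _ (s≤s ())
standardFactorisation {w = c ∷ r@(_ ∷ _)} (_ , smallerʷ) _ with findLeastSuffix r (λ ())
... | leastSuffix v v≢[] (p , r≡pv) least = c ∷ p , v , w≡uv , ((λ ()) , smallerᵘ) , (v≢[] , smallerᵛ)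
  where
  w≡uv : c ∷ r ≡ (c ∷ p) ++ v
  w≡uv = cong (c ∷_) r≡pv

  smallerᵛ : ∀ x s → x ≢ [] → s ≢ [] → v ≡ x ++ s → v <ˡ s
  smallerᵛ x s x≢[] s≢[] v≡xs with least s s≢[] (p ++ x , trans r≡pv (trans (cong (p ++_) v≡xs) (sym (++-assoc p x s))))
  ... | inj₁ v<s = v<s
  ... | inj₂ v≡s = ⊥-elim (s≢x++s x≢[] (trans (sym v≡s) v≡xs))

  w<sv : ∀ {q s} → q ≢ [] → s ≢ [] → c ∷ p ≡ q ++ s → (c ∷ r) <ˡ (s ++ v)
  w<sv {q} {s} q≢[] s≢[] u≡qs =
    smallerʷ q (s ++ v) q≢[] (s≢[] ∘ ++-conicalˡ s v) (trans w≡uv (trans (cong (_++ v) u≡qs) (++-assoc q s v)))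

  smallerᵘ : ∀ q s → q ≢ [] → s ≢ [] → c ∷ p ≡ q ++ s → (c ∷ p) <ˡ s
  smallerᵘ q s q≢[] s≢[] u≡qs with <ˡ-cmp (c ∷ p) s
  ... | tri< u<s _ _ = u<s
  ... | tri≈ _ u≡s _ = ⊥-elim (s≢x++s q≢[] (trans (sym u≡s) u≡qs))
  ... | tri> _ _ s<u with <ˡ-prefix⊎mismatch s<u
  ...   | inj₂ mismatch =
    ⊥-elim (<ˡ-asym (w<sv q≢[] s≢[] u≡qs) (subst ((s ++ v) <ˡ_) (sym w≡uv) (mismatch v v)))
  ...   | inj₁ (t , u≡st) =
    ⊥-elim ([ (λ v<tv → <ˡ-asym v<tv tv<v) , s≢x++s t≢[] ]
              (least (t ++ v) (t≢[] ∘ ++-conicalˡ t v) (suffix-tail w≡stv s≢[])))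
    where
    t≢[] : t ≢ []
    t≢[] refl = s≢x++s q≢[] (trans (sym (trans u≡st (++-identityʳ s))) u≡qs)
    w≡stv : c ∷ r ≡ s ++ (t ++ v)
    w≡stv = trans w≡uv (trans (cong (_++ v) u≡st) (++-assoc s t v))
    tv<v : (t ++ v) <ˡ v
    tv<v = ++-cancelˡ-<ˡ s (subst (_<ˡ (s ++ v)) w≡stv (w<sv q≢[] s≢[] u≡qs))

factor-refl : Factor w w
factor-refl {w = w} = [] , [] , sym (++-identityʳ w)

factor-++ˡ : Factor u (u ++ v)
factor-++ˡ {v = v} = [] , v , refl

factor-++ʳ : Factor v (u ++ v)
factor-++ʳ {v = v} {u = u} = u , [] , cong (u ++_) (sym (++-identityʳ v))

factor-trans : Factor u v → Factor v w → Factor u w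
factor-trans {u = u} {v = v} {w = w} (x′ , y′ , v≡x′uy′) (x , y , w≡xvy) = x ++ x′ , y′ ++ y , (begin
  w                           ≡⟨ w≡xvy ⟩
  x ++ v ++ y                 ≡⟨ cong (λ v → x ++ v ++ y) v≡x′uy′ ⟩
  x ++ (x′ ++ u ++ y′) ++ y   ≡⟨ cong (x ++_) (++-assoc x′ (u ++ y′) y) ⟩
  x ++ x′ ++ (u ++ y′) ++ y   ≡⟨ cong (λ z → x ++ x′ ++ z) (++-assoc u y′ y) ⟩
  x ++ x′ ++ u ++ y′ ++ y     ≡⟨ sym (++-assoc x x′ _) ⟩
  (x ++ x′) ++ u ++ y′ ++ y   ∎)
  where open ≡-Reasoning

factor-length : Factor u w → length u ≤ length w
factor-length {u = u} (x , y , refl) = ≤-trans (length-++-≤ˡ u) (length-++-≤ʳ (u ++ y) {x})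

factor-antisym : Factor u v → Factor v u → u ≡ v
factor-antisym {u = u} ([] , [] , refl) _ = sym (++-identityʳ u)
factor-antisym {u = u} ([] , _ ∷ _ , refl) v⊑u = ⊥-elim (≤⇒≯ (factor-length v⊑u) (length-<-++ˡ u (λ ())))
factor-antisym {u = u} (c ∷ x , y , refl) v⊑u =
  ⊥-elim (≤⇒≯ (factor-length v⊑u) (≤-<-trans (length-++-≤ˡ u {y}) (length-<-++ʳ {u = c ∷ x} (λ ()))))

Covers : Word m → List (Word m) → Set
Covers w xs = ∀ u → Factor u w → Lyndon u → u ∈ xs

covers-factor : Factor u w → Covers w xs → Covers u xs
covers-factor u⊑w cover y y⊑u = cover y (factor-trans y⊑u u⊑w)

_≟ʷ_ : (u v : Word m) → Dec (u ≡ v)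
_≟ʷ_ = ≡-dec Fin._≟_

without : Word m → List (Word m) → List (Word m)
without z = filter (λ y → ¬? (y ≟ʷ z))

length-without : z ∈ xs → length (without z xs) < length xs
length-without {z = z} {xs = xs} z∈xs =
  filter-notAll (λ y → ¬? (y ≟ʷ z)) xs (Any.map (λ z≡y y≢z → y≢z (sym z≡y)) z∈xs)

covers-without : ¬ Factor z w → Covers w xs → Covers w (without z xs)
covers-without {z = z} z⋢w cover y y⊑w ly = ∈-filter⁺ (λ y → ¬? (y ≟ʷ z)) (cover y y⊑w ly) λ { refl → z⋢w y⊑w }

∈⇒1≤length : z ∈ xs → 1 ≤ length xs
∈⇒1≤length (here _)  = s≤s z≤n
∈⇒1≤length (there _) = s≤s z≤n

Covered : Word m → ℕ → Set
Covered {m} w n = ∃ λ (xs : List (Word m)) → length xs ≤ n × Covers w xs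

unique-⊆⇒length≤ : Unique xs → (∀ {z} → z ∈ xs → z ∈ ys) → length xs ≤ length ys
unique-⊆⇒length≤ []                   _     = z≤n
unique-⊆⇒length≤ {xs = x ∷ xs} {ys = ys} (x∉xs ∷ unique) xs⊆ys =
  ≤-trans (s≤s (unique-⊆⇒length≤ unique xs⊆ys∖x)) (length-without (xs⊆ys (here refl)))
  where
  xs⊆ys∖x : ∀ {z} → z ∈ xs → z ∈ without x ys
  xs⊆ys∖x z∈xs = ∈-filter⁺ (λ y → ¬? (y ≟ʷ x)) (xs⊆ys (there z∈xs)) λ z≡x → lookup x∉xs z∈xs (sym z≡x)

numLyndonFactors-≤ : NumLyndonFactors w N → Covered w n → N ≤ n
numLyndonFactors-≤ (xs , unique , refl , spec) (ys , |ys|≤n , cover) =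
  ≤-trans (unique-⊆⇒length≤ unique xs⊆ys) |ys|≤n
  where
  xs⊆ys : ∀ {z} → z ∈ xs → z ∈ ys
  xs⊆ys {z} z∈xs with z⊑w , lz ← proj₁ (spec z) z∈xs = cover z z⊑w lz

-- Fibonacci numbers and powers of the golden ratio

fib-≤-suc : ∀ n → fib n ≤ fib (suc n)
fib-≤-suc zero    = z≤n
fib-≤-suc (suc n) = m≤m+n (fib (suc n)) (fib n)

fib-mono : j ≤ k → fib j ≤ fib k
fib-mono = mono′ ∘ ≤⇒≤′
  where
  mono′ : j ≤′ k → fib j ≤ fib k
  mono′ ≤′-refl      = ≤-refl
  mono′ (≤′-step {n} j≤k) = ≤-trans (mono′ j≤k) (fib-≤-suc n)

fib-pos : 1 ≤ n → 1 ≤ fib n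
fib-pos = fib-mono

fib-+-≤ : j < k → k < n → fib j + fib k ≤ fib n
fib-+-≤ {j} {suc k} {suc (suc n)} (s≤s j≤k) (s≤s (s≤s k≤n)) =
  subst (fib j + fib (suc k) ≤_) (+-comm (fib n) (fib (suc n))) (+-mono-≤ (fib-mono (≤-trans j≤k k≤n)) (fib-mono (s≤s k≤n)))

lucas+fib : ∀ j → lucas j + fib j ≡ 2 * fib (suc j)
lucas+fib zero          = refl
lucas+fib (suc zero)    = refl
lucas+fib (suc (suc j)) = begin
  lucas (suc j) + lucas j + (fib (suc j) + fib j)    ≡⟨ interchange (lucas (suc j)) (lucas j) (fib (suc j)) (fib j) ⟩
  (lucas (suc j) + fib (suc j)) + (lucas j + fib j)  ≡⟨ cong₂ _+_ (lucas+fib (suc j)) (lucas+fib j) ⟩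
  2 * fib (suc (suc j)) + 2 * fib (suc j)            ≡⟨ sym (*-distribˡ-+ 2 (fib (suc (suc j))) (fib (suc j))) ⟩
  2 * fib (suc (suc (suc j)))                        ∎
  where open ≡-Reasoning

PhiPowGe-antitone : ∀ j → n ≤ N → PhiPowGe j N → PhiPowGe j n
PhiPowGe-antitone j n≤N = ≤-trans (^-monoˡ-≤ 2 (∸-monoˡ-≤ (lucas j) (*-monoʳ-≤ 2 n≤N)))

-- Since 2 F_(j+1) ∸ L_j = F_j.
PhiPowGe-fib : ∀ j → PhiPowGe j (fib (suc j))
PhiPowGe-fib j rewrite sym (lucas+fib j) | m+n∸m≡n (lucas j) (fib j) = m≤n*m (fib j ^ 2) 5

2*fib[3+j] : ∀ j → 2 * fib (3 + j) ≡ lucas (suc j) + 3 * fib (suc j)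
2*fib[3+j] j = begin
  2 * (fib (2 + j) + fib (1 + j))                   ≡⟨ *-distribˡ-+ 2 (fib (2 + j)) (fib (1 + j)) ⟩
  2 * fib (2 + j) + 2 * fib (1 + j)                 ≡⟨ cong (_+ 2 * fib (1 + j)) (sym (lucas+fib (suc j))) ⟩
  lucas (1 + j) + fib (1 + j) + 2 * fib (1 + j)     ≡⟨ +-assoc (lucas (1 + j)) (fib (1 + j)) _ ⟩
  lucas (1 + j) + 3 * fib (1 + j)                   ∎
  where open ≡-Reasoning

-- Since 2 F_(j+3) ∸ L_(j+1) = 3 F_(j+1) and 9 > 5.
¬PhiPowGe-fib : ∀ j → ¬ PhiPowGe (suc j) (fib (3 + j))
¬PhiPowGe-fib j φ≥ = ≤⇒≯ 9F²≤5F² (begin-strict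
  5 * F ^ 2              <⟨ m<m+n (5 * F ^ 2) (≤-trans (s≤s z≤n) (*-monoʳ-≤ 4 (^-monoˡ-≤ 2 (fib-pos {suc j} (s≤s z≤n))))) ⟩
  5 * F ^ 2 + 4 * F ^ 2  ≡⟨ 5p²+4p²≡[3p]² F ⟩
  (3 * F) ^ 2            ∎)
  where
  open ≤-Reasoning
  F : ℕ
  F = fib (suc j)
  5p²+4p²≡[3p]² : ∀ p → 5 * (p * (p * 1)) + 4 * (p * (p * 1)) ≡ (3 * p) * ((3 * p) * 1)
  5p²+4p²≡[3p]² = solve-∀
  9F²≤5F² : (3 * F) ^ 2 ≤ 5 * F ^ 2
  9F²≤5F² = subst (λ z → z ^ 2 ≤ 5 * F ^ 2)
    (trans (cong (_∸ lucas (suc j)) (2*fib[3+j] j)) (m+n∸m≡n (lucas (suc j)) (3 * F))) φ≥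

ceilLogPhi-≤ : IsCeilLogPhi n k → n ≤ fib (suc j) → k ≤ j
ceilLogPhi-≤ {k = k} {j = j} (_ , minimal) n≤F with k ≤? j
... | yes k≤j = k≤j
... | no  k≰j = ⊥-elim (minimal j (≰⇒> k≰j) (PhiPowGe-antitone j n≤F (PhiPowGe-fib j)))

ceilLogPhi-fib : IsCeilLogPhi (fib (3 + j)) k → 2 + j ≤ k
ceilLogPhi-fib {j = j} {k = k} (φᵏ≥ , _) with k ≤? suc j
... | no  k≰1+j = ≰⇒> k≰1+j
... | yes k≤1+j = ⊥-elim (φᵏ≱ k k≤1+j φᵏ≥)
  where
  φᵏ≱ : ∀ k → k ≤ suc j → ¬ PhiPowGe k (fib (3 + j))
  φᵏ≱ zero    _         φ⁰≥ =
    contradiction (PhiPowGe-antitone 0 (fib-mono {3} {3 + j} (s≤s (s≤s (s≤s z≤n)))) φ⁰≥) λ ()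
  φᵏ≱ (suc i) (s≤s i≤j) φᵏ≥ =
    ¬PhiPowGe-fib i (PhiPowGe-antitone (suc i) (fib-mono {3 + i} {3 + j} (s≤s (s≤s (s≤s i≤j)))) φᵏ≥)

-- Lower bound

length≤fib-cover : Acc _<_ (length w) → SmallerThanSuffixes w → Covers w xs → length w ≤ fib (length xs)
length≤fib-cover {w = w} {xs = xs} (acc rec) slw cover with length w ≤? 1
... | yes |w|≤1 = ≤-trans |w|≤1 (fib-pos (∈⇒1≤length (cover w factor-refl (SmallerThanSuffixes⇒Lyndon slw))))
... | no |w|≰1 with standardFactorisation slw (≰⇒> |w|≰1)
...   | u , v , refl , slu@(u≢[] , _) , slv@(v≢[] , _) =
  -- Factor is not shown decidable, but the goal is, so the case split on it may be classical.
  decidable-stable (_ ≤? _) λ ¬bound → ¬¬-excluded-middle (¬bound ∘ byCases)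
  where
  |u|<|w| : length u < length (u ++ v)
  |u|<|w| = length-<-++ˡ u v≢[]
  |v|<|w| : length v < length (u ++ v)
  |v|<|w| = length-<-++ʳ u≢[]

  xs₁ : List (Word _)
  xs₁ = without (u ++ v) xs
  coverᵘ : Covers u xs₁
  coverᵘ = covers-without (λ w⊑u → ≤⇒≯ (factor-length w⊑u) |u|<|w|) (covers-factor factor-++ˡ cover)
  coverᵛ : Covers v xs₁
  coverᵛ = covers-without (λ w⊑v → ≤⇒≯ (factor-length w⊑v) |v|<|w|) (covers-factor factor-++ʳ cover)

  bound : ∀ {s t} → length s < length (u ++ v) → length t < length (u ++ v) →
          SmallerThanSuffixes s → SmallerThanSuffixes t → ¬ Factor t s → Covers s xs₁ → Covers t xs₁ →
          length s + length t ≤ fib (length xs)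
  bound |s|<|w| |t|<|w| sls slt t⋢s coverˢ coverᵗ = ≤-trans
    (+-mono-≤ (length≤fib-cover (rec |s|<|w|) sls (covers-without t⋢s coverˢ))
              (length≤fib-cover (rec |t|<|w|) slt coverᵗ))
    (fib-+-≤ (length-without (coverᵗ _ factor-refl (SmallerThanSuffixes⇒Lyndon slt)))
             (length-without (cover _ factor-refl (SmallerThanSuffixes⇒Lyndon slw))))

  byCases : Dec (Factor v u) → length (u ++ v) ≤ fib (length xs)
  byCases (no v⋢u)  = subst (_≤ _) (sym (length-++ u)) (bound |u|<|w| |v|<|w| slu slv v⋢u coverᵘ coverᵛ)
  byCases (yes v⊑u) = subst (_≤ _) (trans (+-comm (length v) (length u)) (sym (length-++ u)))
                            (bound |v|<|w| |u|<|w| slv slu u⋢v coverᵛ coverᵘ)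
    where
    u⋢v : ¬ Factor u v
    u⋢v u⊑v = u++t≮ˡu u v (proj₂ slw u u u≢[] u≢[] (cong (u ++_) (sym (factor-antisym u⊑v v⊑u))))

lyndon-length≤fib : Lyndon w → NumLyndonFactors w N → length w ≤ fib N
lyndon-length≤fib lw (xs , _ , refl , spec) =
  length≤fib-cover (<-wellFounded _) (Lyndon⇒SmallerThanSuffixes lw) λ u u⊑w lu → proj₂ (spec u) (u⊑w , lu)

lyndon-1≤numLyndonFactors : Lyndon w → NumLyndonFactors w N → 1 ≤ N
lyndon-1≤numLyndonFactors lw (xs , _ , refl , spec) = ∈⇒1≤length (proj₂ (spec _) (factor-refl , lw))

lowerBound : Lyndon w → IsCeilLogPhi (length w) k → NumLyndonFactors w N → k + 1 ≤ N
lowerBound {k = k} lw ceil nf with lyndon-1≤numLyndonFactors lw nf | lyndon-length≤fib lw nf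
... | s≤s {n = j} _ | |w|≤F = subst (_≤ suc j) (+-comm 1 k) (s≤s (ceilLogPhi-≤ ceil |w|≤F))

concatMap-++ : ∀ (h : Fin n → Word m) x y → concatMap h (x ++ y) ≡ concatMap h x ++ concatMap h y
concatMap-++ h x y = trans (cong concat (map-++ h x y)) (sym (concat-++ (map h x) (map h y)))

[]<ˡ : u ≢ [] → [] <ˡ u
[]<ˡ {u = []}    u≢[] = ⊥-elim (u≢[] refl)
[]<ˡ {u = _ ∷ _} _    = halt

record OrderedMorphism (h : Fin n → Word m) : Set where
  field
    nonErasing : ∀ c → h c ≢ []
    ordered    : ∀ {c d} u v → c <ᶠ d → concatMap h (c ∷ u) <ˡ concatMap h (d ∷ v)

module OrderedMorphismProperties {h : Fin n → Word m} (ordered-h : OrderedMorphism h) where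
  open OrderedMorphism ordered-h

  h* : Word n → Word m
  h* = concatMap h

  h*-≢[] : ∀ {u} → u ≢ [] → h* u ≢ []
  h*-≢[] {[]}    u≢[] = ⊥-elim (u≢[] refl)
  h*-≢[] {c ∷ u} _    = nonErasing c ∘ ++-conicalˡ (h c) (h* u)

  h*-mono-<ˡ : ∀ {u v} → u <ˡ v → h* u <ˡ h* v
  h*-mono-<ˡ (base ())
  h*-mono-<ˡ (halt {y} {ys}) = []<ˡ (h*-≢[] {y ∷ ys} (λ ()))
  h*-mono-<ˡ {_ ∷ u} {_ ∷ v} (this c<d) = ordered u v c<d
  h*-mono-<ˡ (next refl u<v) = ++-monoʳ-<ˡ (h _) (h*-mono-<ˡ u<v)

  h*-reflects-<ˡ : ∀ u v → h* u <ˡ h* v → u <ˡ v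
  h*-reflects-<ˡ u v hu<hv with <ˡ-cmp u v
  ... | tri< u<v _ _  = u<v
  ... | tri≈ _ refl _ = ⊥-elim (<ˡ-irrefl hu<hv)
  ... | tri> _ _ v<u  = ⊥-elim (<ˡ-asym hu<hv (h*-mono-<ˡ v<u))

  h*-reflects-Lyndon : ∀ {y} → Lyndon (h* y) → Lyndon y
  h*-reflects-Lyndon {y} lhy = SmallerThanSuffixes⇒Lyndon (y≢[] , smaller)
    where
    slhy : SmallerThanSuffixes (h* y)
    slhy = Lyndon⇒SmallerThanSuffixes lhy
    y≢[] : y ≢ []
    y≢[] refl = proj₁ slhy refl
    smaller : ∀ x s → x ≢ [] → s ≢ [] → y ≡ x ++ s → y <ˡ s
    smaller x s x≢[] s≢[] refl =
      h*-reflects-<ˡ (x ++ s) s (proj₂ slhy (h* x) (h* s) (h*-≢[] x≢[]) (h*-≢[] s≢[]) (concatMap-++ h x s))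

  covered-image : ∀ {x k} (extras : List (Word m)) →
    (∀ z → Factor z (h* x) → Lyndon z → z ∈ extras ⊎ ∃ λ y → Factor y x × h* y ≡ z) →
    Covered x k → Covered (h* x) (length extras + k)
  covered-image {x} {k} extras classify (ys , |ys|≤k , cover) =
    extras ++ map h* ys , |extras++hys|≤ , cover′
    where
    |extras++hys|≤ : length (extras ++ map h* ys) ≤ length extras + k
    |extras++hys|≤ rewrite length-++ extras {map h* ys} | length-map h* ys = +-monoʳ-≤ (length extras) |ys|≤k
    cover′ : Covers (h* x) (extras ++ map h* ys)
    cover′ z z⊑hx lz with classify z z⊑hx lz
    ... | inj₁ z∈extras            = ∈-++⁺ˡ z∈extras
    ... | inj₂ (y , y⊑x , refl) = ∈-++⁺ʳ extras (∈-map⁺ h* (cover y y⊑x (h*-reflects-Lyndon lz)))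

CutsAt : (Fin n → Word m) → Word n → Word m → Word m → Set
CutsAt {n} h x l r = ∃₂ λ (x₁ x₂ : Word n) → x ≡ x₁ ++ x₂ × concatMap h x₁ ≡ l × concatMap h x₂ ≡ r

∷-cutsAt : ∀ {h : Fin n → Word m} {x : Word n} {l r} c → CutsAt h x l r → CutsAt h (c ∷ x) (h c ++ l) r
∷-cutsAt c (x₁ , x₂ , refl , refl , refl) = c ∷ x₁ , x₂ , refl , refl , refl

cuts⇒factor : ∀ {h : Fin n → Word m} {x : Word n} {p z q} → CutsAt h x p (z ++ q) →
  (∀ {x₂} → concatMap h x₂ ≡ z ++ q → CutsAt h x₂ z q) → ∃ λ y → Factor y x × concatMap h y ≡ z
cuts⇒factor (x₁ , x₂ , refl , _ , hx₂≡zq) cutᶻ with cutᶻ {x₂} hx₂≡zq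
... | y , x₃ , refl , hy≡z , _ = y , (x₁ , x₃ , refl) , hy≡z

-- Binary Fibonacci Lyndon words

pattern A = zero
pattern B = suc zero

binary-< : {c d : Fin 2} → c <ᶠ d → c ≡ A × d ≡ B
binary-< {A} {B} _         = refl , refl
binary-< {B} {B} (s≤s ())

binaryLyndon-shape : {z : Word 2} → Lyndon z → 2 ≤ length z → ∃ λ z′ → z ≡ A ∷ z′ ++ B ∷ []
binaryLyndon-shape {c ∷ r} lz 2≤|z| with initLast r | Lyndon⇒SmallerThanSuffixes lz
binaryLyndon-shape _ (s≤s ()) | [] | _
... | r′ ∷ʳ′ d | _ , smaller with smaller (c ∷ r′) (d ∷ []) (λ ()) (λ ()) refl
...   | next _ q = ⊥-elim (Lex.xs≮[] q)
...   | this c<d with binary-< c<d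
...     | refl , refl = r′ , refl

α β : Fin 2 → Word 2
α A = A ∷ []
α B = A ∷ B ∷ []
β A = A ∷ B ∷ []
β B = B ∷ []

α-ordered : OrderedMorphism α
α-ordered = record { nonErasing = λ { A () ; B () } ; ordered = ordered }
  where
  α*<ˡb : ∀ u t → concatMap α u <ˡ (B ∷ t)
  α*<ˡb []      t = halt
  α*<ˡb (A ∷ u) t = this (s≤s z≤n)
  α*<ˡb (B ∷ u) t = this (s≤s z≤n)
  ordered : ∀ {c d} u v → c <ᶠ d → concatMap α (c ∷ u) <ˡ concatMap α (d ∷ v)
  ordered {A} {B} u v _ = next refl (α*<ˡb u _)
  ordered {B} {B} u v (s≤s ())

β-ordered : OrderedMorphism β
β-ordered = record { nonErasing = λ { A () ; B () } ; ordered = ordered }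
  where
  ordered : ∀ {c d} u v → c <ᶠ d → concatMap β (c ∷ u) <ˡ concatMap β (d ∷ v)
  ordered {A} {B} u v _ = this (s≤s z≤n)
  ordered {B} {B} u v (s≤s ())

-- In an α- or β-image every a starts, and every b ends, the image of a letter.
α-cutBefore-a : ∀ x p s → concatMap α x ≡ p ++ A ∷ s → CutsAt α x p (A ∷ s)
α-cutBefore-a x       []          s hx≡ = [] , x , refl , refl , hx≡
α-cutBefore-a []      (_ ∷ _)     s ()
α-cutBefore-a (A ∷ x) (_ ∷ p)     s hx≡ with refl ← ∷-injectiveˡ hx≡ =
  ∷-cutsAt A (α-cutBefore-a x p s (∷-injectiveʳ hx≡))
α-cutBefore-a (B ∷ x) (_ ∷ [])    s hx≡ with () ← ∷-injectiveˡ (∷-injectiveʳ hx≡)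
α-cutBefore-a (B ∷ x) (_ ∷ _ ∷ p) s hx≡ with refl ← ∷-injectiveˡ hx≡ | refl ← ∷-injectiveˡ (∷-injectiveʳ hx≡) =
  ∷-cutsAt B (α-cutBefore-a x p s (∷-injectiveʳ (∷-injectiveʳ hx≡)))

β-cutBefore-a : ∀ x p s → concatMap β x ≡ p ++ A ∷ s → CutsAt β x p (A ∷ s)
β-cutBefore-a x       []          s hx≡ = [] , x , refl , refl , hx≡
β-cutBefore-a []      (_ ∷ _)     s ()
β-cutBefore-a (A ∷ x) (_ ∷ [])    s hx≡ with () ← ∷-injectiveˡ (∷-injectiveʳ hx≡)
β-cutBefore-a (A ∷ x) (_ ∷ _ ∷ p) s hx≡ with refl ← ∷-injectiveˡ hx≡ | refl ← ∷-injectiveˡ (∷-injectiveʳ hx≡) =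
  ∷-cutsAt A (β-cutBefore-a x p s (∷-injectiveʳ (∷-injectiveʳ hx≡)))
β-cutBefore-a (B ∷ x) (_ ∷ p)     s hx≡ with refl ← ∷-injectiveˡ hx≡ =
  ∷-cutsAt B (β-cutBefore-a x p s (∷-injectiveʳ hx≡))

α-cutAfter-b : ∀ x p s → concatMap α x ≡ p ++ B ∷ s → CutsAt α x (p ++ B ∷ []) s
α-cutAfter-b []      []          s ()
α-cutAfter-b []      (_ ∷ _)     s ()
α-cutAfter-b (A ∷ x) []          s hx≡ with () ← ∷-injectiveˡ hx≡
α-cutAfter-b (A ∷ x) (_ ∷ p)     s hx≡ with refl ← ∷-injectiveˡ hx≡ =
  ∷-cutsAt A (α-cutAfter-b x p s (∷-injectiveʳ hx≡))
α-cutAfter-b (B ∷ x) []          s hx≡ with () ← ∷-injectiveˡ hx≡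
α-cutAfter-b (B ∷ x) (_ ∷ [])    s hx≡ with refl ← ∷-injectiveˡ hx≡ =
  B ∷ [] , x , refl , refl , ∷-injectiveʳ (∷-injectiveʳ hx≡)
α-cutAfter-b (B ∷ x) (_ ∷ _ ∷ p) s hx≡ with refl ← ∷-injectiveˡ hx≡ | refl ← ∷-injectiveˡ (∷-injectiveʳ hx≡) =
  ∷-cutsAt B (α-cutAfter-b x p s (∷-injectiveʳ (∷-injectiveʳ hx≡)))

β-cutAfter-b : ∀ x p s → concatMap β x ≡ p ++ B ∷ s → CutsAt β x (p ++ B ∷ []) s
β-cutAfter-b []      []          s ()
β-cutAfter-b []      (_ ∷ _)     s ()
β-cutAfter-b (A ∷ x) []          s hx≡ with () ← ∷-injectiveˡ hx≡
β-cutAfter-b (A ∷ x) (_ ∷ [])    s hx≡ with refl ← ∷-injectiveˡ hx≡ =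
  A ∷ [] , x , refl , refl , ∷-injectiveʳ (∷-injectiveʳ hx≡)
β-cutAfter-b (A ∷ x) (_ ∷ _ ∷ p) s hx≡ with refl ← ∷-injectiveˡ hx≡ | refl ← ∷-injectiveˡ (∷-injectiveʳ hx≡) =
  ∷-cutsAt A (β-cutAfter-b x p s (∷-injectiveʳ (∷-injectiveʳ hx≡)))
β-cutAfter-b (B ∷ x) []          s hx≡ = B ∷ [] , x , refl , refl , ∷-injectiveʳ hx≡
β-cutAfter-b (B ∷ x) (_ ∷ p)     s hx≡ with refl ← ∷-injectiveˡ hx≡ =
  ∷-cutsAt B (β-cutAfter-b x p s (∷-injectiveʳ hx≡))

synchronised-factor : ∀ {h : Fin 2 → Word 2} →
  (∀ x p s → concatMap h x ≡ p ++ A ∷ s → CutsAt h x p (A ∷ s)) →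
  (∀ x p s → concatMap h x ≡ p ++ B ∷ s → CutsAt h x (p ++ B ∷ []) s) →
  ∀ {x z z′} → z ≡ A ∷ z′ ++ B ∷ [] → Factor z (concatMap h x) → ∃ λ y → Factor y x × concatMap h y ≡ z
synchronised-factor cutBefore-a cutAfter-b {x} {z′ = z′} refl (p , q , hx≡pzq) =
  cuts⇒factor (cutBefore-a x p _ hx≡pzq)
    λ {x₂} hx₂≡zq → cutAfter-b x₂ (A ∷ z′) q (trans hx₂≡zq (cong (A ∷_) (++-assoc z′ (B ∷ []) q)))

private
  module α* = OrderedMorphismProperties α-ordered
  module β* = OrderedMorphismProperties β-ordered

α-covered : ∀ {x k} → Covered (A ∷ x) k → Covered (concatMap α (A ∷ x)) (suc k)
α-covered {x} = α*.covered-image ((B ∷ []) ∷ []) classify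
  where
  classify : ∀ z → Factor z (concatMap α (A ∷ x)) → Lyndon z →
             z ∈ (B ∷ []) ∷ [] ⊎ ∃ λ y → Factor y (A ∷ x) × concatMap α y ≡ z
  classify []            _   (() , _)
  classify (A ∷ [])      _   _  = inj₂ (A ∷ [] , ([] , x , refl) , refl)
  classify (B ∷ [])      _   _  = inj₁ (here refl)
  classify (_ ∷ _ ∷ _)   z⊑ lz  =
    inj₂ (synchronised-factor α-cutBefore-a α-cutAfter-b (proj₂ (binaryLyndon-shape lz (s≤s (s≤s z≤n)))) z⊑)

β-covered : ∀ {x k} → Covered (x ++ B ∷ []) k → Covered (concatMap β (x ++ B ∷ [])) (suc k)
β-covered {x} = β*.covered-image ((A ∷ []) ∷ []) classify
  where
  classify : ∀ z → Factor z (concatMap β (x ++ B ∷ [])) → Lyndon z →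
             z ∈ (A ∷ []) ∷ [] ⊎ ∃ λ y → Factor y (x ++ B ∷ []) × concatMap β y ≡ z
  classify []            _   (() , _)
  classify (A ∷ [])      _   _  = inj₁ (here refl)
  classify (B ∷ [])      _   _  = inj₂ (B ∷ [] , (x , [] , refl) , refl)
  classify (_ ∷ _ ∷ _)   z⊑ lz  =
    inj₂ (synchronised-factor β-cutBefore-a β-cutAfter-b (proj₂ (binaryLyndon-shape lz (s≤s (s≤s z≤n)))) z⊑)

φ : Fin 2 → Word 2
φ A = A ∷ B ∷ []
φ B = A ∷ []

exchange : Fin 2 → Fin 2
exchange A = B
exchange B = A

-- Q k is p_(k+3); G k and H k are the Fibonacci Lyndon words a p b and a c(p) b of length F_(k+3).
Q : ℕ → Word 2
Q zero    = []
Q (suc k) = concatMap φ (Q k) ++ A ∷ []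

G H : ℕ → Word 2
G k = A ∷ Q k ++ B ∷ []
H k = A ∷ map exchange (Q k) ++ B ∷ []

α∘exchange : ∀ q → concatMap α (map exchange q) ≡ concatMap φ q
α∘exchange []      = refl
α∘exchange (A ∷ q) = cong (λ r → A ∷ B ∷ r) (α∘exchange q)
α∘exchange (B ∷ q) = cong (A ∷_) (α∘exchange q)

exchange∘φ : ∀ q → map exchange (concatMap φ q) ++ B ∷ [] ≡ B ∷ concatMap β q
exchange∘φ []      = refl
exchange∘φ (A ∷ q) = cong (λ r → B ∷ A ∷ r) (exchange∘φ q)
exchange∘φ (B ∷ q) = cong (B ∷_) (exchange∘φ q)

G-suc : ∀ k → G (suc k) ≡ concatMap α (H k)
G-suc k = cong (A ∷_) (begin
  (concatMap φ (Q k) ++ A ∷ []) ++ B ∷ []          ≡⟨ ++-assoc (concatMap φ (Q k)) (A ∷ []) (B ∷ []) ⟩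
  concatMap φ (Q k) ++ A ∷ B ∷ []                  ≡⟨ cong (_++ A ∷ B ∷ []) (sym (α∘exchange (Q k))) ⟩
  concatMap α (map exchange (Q k)) ++ A ∷ B ∷ []   ≡⟨ sym (concatMap-++ α (map exchange (Q k)) (B ∷ [])) ⟩
  concatMap α (map exchange (Q k) ++ B ∷ [])       ∎)
  where open ≡-Reasoning

H-suc : ∀ k → H (suc k) ≡ concatMap β (G k)
H-suc k = cong (A ∷_) (begin
  map exchange (concatMap φ (Q k) ++ A ∷ []) ++ B ∷ []    ≡⟨ cong (_++ B ∷ []) (map-++ exchange (concatMap φ (Q k)) (A ∷ [])) ⟩
  (map exchange (concatMap φ (Q k)) ++ B ∷ []) ++ B ∷ []  ≡⟨ cong (_++ B ∷ []) (exchange∘φ (Q k)) ⟩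
  B ∷ concatMap β (Q k) ++ B ∷ []                        ≡⟨ cong (B ∷_) (sym (concatMap-++ β (Q k) (B ∷ []))) ⟩
  B ∷ concatMap β (Q k ++ B ∷ [])                        ∎)
  where open ≡-Reasoning

ab-covered : Covered (A ∷ B ∷ []) 3
ab-covered = (A ∷ []) ∷ (B ∷ []) ∷ (A ∷ B ∷ []) ∷ [] , ≤-refl , cover
  where
  factors : ∀ (p : Word 2) c z q → A ∷ B ∷ [] ≡ p ++ (c ∷ z) ++ q →
            (c ∷ z) ∈ (A ∷ []) ∷ (B ∷ []) ∷ (A ∷ B ∷ []) ∷ []
  factors []          _ []          _ refl = here refl
  factors []          _ (_ ∷ [])    _ refl = there (there (here refl))
  factors []          _ (_ ∷ _ ∷ _) _ ()
  factors (_ ∷ [])    _ []          _ refl = there (here refl)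
  factors (_ ∷ [])    _ (_ ∷ _)     _ ()
  factors (_ ∷ _ ∷ []) _ _          _ ()
  factors (_ ∷ _ ∷ _ ∷ _) _ _       _ ()
  cover : Covers (A ∷ B ∷ []) ((A ∷ []) ∷ (B ∷ []) ∷ (A ∷ B ∷ []) ∷ [])
  cover []      _                 (() , _)
  cover (c ∷ z) (p , q , ab≡pzq) _ = factors p c z q ab≡pzq

GH-covered : ∀ k → Covered (G k) (3 + k) × Covered (H k) (3 + k)
GH-covered zero    = ab-covered , ab-covered
GH-covered (suc k) with G-covered , H-covered ← GH-covered k =
  subst (λ w → Covered w (4 + k)) (sym (G-suc k)) (α-covered H-covered) ,
  subst (λ w → Covered w (4 + k)) (sym (H-suc k)) (β-covered {x = A ∷ Q k} G-covered)

fibWord₂ : ℕ → Word 2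
fibWord₂ = fibWord A B

fibWord-φ : ∀ k → fibWord₂ (2 + k) ≡ concatMap φ (fibWord₂ (1 + k))
fibWord-φ zero          = refl
fibWord-φ (suc zero)    = refl
fibWord-φ (suc (suc k)) =
  trans (cong₂ _++_ (fibWord-φ (suc k)) (fibWord-φ k)) (sym (concatMap-++ φ (fibWord₂ (2 + k)) (fibWord₂ (1 + k))))

fibWord-φ-Q : ∀ {k t} → fibWord₂ (3 + k) ≡ Q k ++ t → fibWord₂ (4 + k) ≡ concatMap φ (Q k) ++ concatMap φ t
fibWord-φ-Q {k} {t} f≡Qt = trans (fibWord-φ (2 + k)) (trans (cong (concatMap φ) f≡Qt) (concatMap-++ φ (Q k) t))

fibWord-Q : ∀ k → ∃ λ t → fibWord₂ (3 + k) ≡ Q k ++ t × (t ≡ A ∷ B ∷ [] ⊎ t ≡ B ∷ A ∷ [])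
fibWord-Q zero = A ∷ B ∷ [] , refl , inj₁ refl
fibWord-Q (suc k) with fibWord-Q k
... | _ , f≡Qt , inj₁ refl =
  B ∷ A ∷ [] , trans (fibWord-φ-Q {k} f≡Qt) (sym (++-assoc (concatMap φ (Q k)) (A ∷ []) _)) , inj₂ refl
... | _ , f≡Qt , inj₂ refl =
  A ∷ B ∷ [] , trans (fibWord-φ-Q {k} f≡Qt) (sym (++-assoc (concatMap φ (Q k)) (A ∷ []) _)) , inj₁ refl

pWord-Q : ∀ k → pWord A B (3 + k) ≡ Q k
pWord-Q k with fibWord-Q k
... | t , f≡Qt , t≡ = begin
  take (length (fibWord₂ (3 + k)) ∸ 2) (fibWord₂ (3 + k))  ≡⟨ cong (λ f → take (length f ∸ 2) f) f≡Qt ⟩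
  take (length (Q k ++ t) ∸ 2) (Q k ++ t)                  ≡⟨ cong (λ n → take n (Q k ++ t)) |Qt|∸2≡|Q| ⟩
  take (length (Q k)) (Q k ++ t)                           ≡⟨ take-length-++ (Q k) t ⟩
  Q k                                                      ∎
  where
  open ≡-Reasoning
  |t|≡2 : length t ≡ 2
  |t|≡2 = [ (λ { refl → refl }) , (λ { refl → refl }) ] t≡
  |Qt|∸2≡|Q| : length (Q k ++ t) ∸ 2 ≡ length (Q k)
  |Qt|∸2≡|Q| rewrite length-++ (Q k) {t} | |t|≡2 = m+n∸n≡m (length (Q k)) 2

length-fibWord : ∀ (a b : Fin m) n → length (fibWord a b n) ≡ fib n
length-fibWord a b zero                = refl
length-fibWord a b (suc zero)          = refl
length-fibWord a b (suc (suc zero))    = refl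
length-fibWord a b (suc (suc (suc n))) =
  trans (length-++ (fibWord a b (suc (suc n)))) (cong₂ _+_ (length-fibWord a b (suc (suc n))) (length-fibWord a b (suc n)))

length-Q : ∀ k → length (Q k) + 2 ≡ fib (3 + k)
length-Q k with fibWord-Q k
... | t , f≡Qt , t≡ = begin
  length (Q k) + 2            ≡⟨ cong (length (Q k) +_) (sym ([ (λ { refl → refl }) , (λ { refl → refl }) ] t≡)) ⟩
  length (Q k) + length t     ≡⟨ sym (length-++ (Q k)) ⟩
  length (Q k ++ t)           ≡⟨ cong length (sym f≡Qt) ⟩
  length (fibWord₂ (3 + k))   ≡⟨ length-fibWord A B (3 + k) ⟩
  fib (3 + k)                 ∎
  where open ≡-Reasoning

length-[a]++x++[b] : ∀ (c d : Fin m) x → length (c ∷ x ++ d ∷ []) ≡ length x + 2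
length-[a]++x++[b] c d x = trans (cong suc (trans (length-++ x) (+-comm (length x) 1))) (+-comm 2 (length x))

length-G : ∀ k → length (G k) ≡ fib (3 + k)
length-G k = trans (length-[a]++x++[b] A B (Q k)) (length-Q k)

length-H : ∀ k → length (H k) ≡ fib (3 + k)
length-H k = trans (length-[a]++x++[b] A B (map exchange (Q k))) (trans (cong (_+ 2) (length-map exchange (Q k))) (length-Q k))

letter : Fin m → Fin m → Fin 2 → Fin m
letter a b A = a
letter a b B = b

ι : Fin m → Fin m → Fin 2 → Word m
ι a b c = letter a b c ∷ []

concatMap-ι : ∀ (a b : Fin m) x → concatMap (ι a b) x ≡ map (letter a b) x
concatMap-ι a b []      = refl
concatMap-ι a b (c ∷ x) = cong (letter a b c ∷_) (concatMap-ι a b x)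

ι-ordered : a <ᶠ b → OrderedMorphism (ι a b)
ι-ordered {a = a} {b = b} a<b = record { nonErasing = λ _ () ; ordered = ordered }
  where
  ordered : ∀ {c d} u v → c <ᶠ d → concatMap (ι a b) (c ∷ u) <ˡ concatMap (ι a b) (d ∷ v)
  ordered {A} {B} u v _ = this a<b
  ordered {B} {B} u v (s≤s ())

ι-cut : ∀ (a b : Fin m) x p r → concatMap (ι a b) x ≡ p ++ r → CutsAt (ι a b) x p r
ι-cut a b x       []      r hx≡ = [] , x , refl , refl , hx≡
ι-cut a b []      (_ ∷ _) r ()
ι-cut a b (c ∷ x) (_ ∷ p) r hx≡ with refl ← ∷-injectiveˡ hx≡ = ∷-cutsAt c (ι-cut a b x p r (∷-injectiveʳ hx≡))

letter-covered : a <ᶠ b → ∀ {x k} → Covered x k → Covered (map (letter a b) x) k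
letter-covered {a = a} {b = b} a<b {x} {k} covered =
  subst (λ w → Covered w k) (concatMap-ι a b x) (covered-image [] classify covered)
  where
  open OrderedMorphismProperties (ι-ordered a<b)
  classify : ∀ z → Factor z (concatMap (ι a b) x) → Lyndon z → z ∈ [] ⊎ ∃ λ y → Factor y x × concatMap (ι a b) y ≡ z
  classify z (p , q , hx≡pzq) _ = inj₂ (cuts⇒factor (ι-cut a b x p (z ++ q) hx≡pzq) λ {x₂} → ι-cut a b x₂ z q)

fibWord-letter : ∀ (a b : Fin m) n → fibWord a b n ≡ map (letter a b) (fibWord₂ n)
fibWord-letter a b zero                = refl
fibWord-letter a b (suc zero)          = refl
fibWord-letter a b (suc (suc zero))    = refl
fibWord-letter a b (suc (suc (suc n))) =
  trans (cong₂ _++_ (fibWord-letter a b (suc (suc n))) (fibWord-letter a b (suc n)))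
        (sym (map-++ (letter a b) (fibWord₂ (suc (suc n))) (fibWord₂ (suc n))))

pWord-letter : ∀ (a b : Fin m) n → pWord a b n ≡ map (letter a b) (pWord A B n)
pWord-letter a b n rewrite fibWord-letter a b n | length-map (letter a b) (fibWord₂ n) =
  take-map (length (fibWord₂ n) ∸ 2) (fibWord₂ n)

swapAB-letter : a ≢ b → ∀ c → swapAB a b (letter a b c) ≡ letter a b (exchange c)
swapAB-letter {a = a} {b = b} a≢b A with a Fin.≟ a
... | yes _   = refl
... | no a≢a = ⊥-elim (a≢a refl)
swapAB-letter {a = a} {b = b} a≢b B with b Fin.≟ a
... | yes b≡a = ⊥-elim (a≢b (sym b≡a))
... | no _ with b Fin.≟ b
...   | yes _   = refl
...   | no b≢b = ⊥-elim (b≢b refl)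

pWord-letter-Q : ∀ (a b : Fin m) j → pWord a b (3 + j) ≡ map (letter a b) (Q j)
pWord-letter-Q a b j = trans (pWord-letter a b (3 + j)) (cong (map (letter a b)) (pWord-Q j))

fibLyndon-letters : IsFibLyndon w →
  ∃₂ λ a b → a <ᶠ b × ∃ λ j → w ≡ map (letter a b) (G j) ⊎ w ≡ map (letter a b) (H j)
fibLyndon-letters (a , b , a<b , suc (suc (suc j)) , _ , inj₁ refl) = a , b , a<b , j , inj₁ (cong (a ∷_) (begin
  pWord a b (3 + j) ++ b ∷ []                     ≡⟨ cong (_++ b ∷ []) (pWord-letter-Q a b j) ⟩
  map (letter a b) (Q j) ++ b ∷ []                ≡⟨ sym (map-++ (letter a b) (Q j) (B ∷ [])) ⟩
  map (letter a b) (Q j ++ B ∷ [])                ∎))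
  where open ≡-Reasoning
fibLyndon-letters (a , b , a<b , suc (suc (suc j)) , _ , inj₂ refl) = a , b , a<b , j , inj₂ (cong (a ∷_) (begin
  map (swapAB a b) (pWord a b (3 + j)) ++ b ∷ []            ≡⟨ cong (λ p → map (swapAB a b) p ++ b ∷ []) (pWord-letter-Q a b j) ⟩
  map (swapAB a b) (map (letter a b) (Q j)) ++ b ∷ []       ≡⟨ cong (_++ b ∷ []) (sym (map-∘ (Q j))) ⟩
  map (swapAB a b ∘ letter a b) (Q j) ++ b ∷ []             ≡⟨ cong (_++ b ∷ []) (map-cong (swapAB-letter (Fin.<⇒≢ a<b)) (Q j)) ⟩
  map (letter a b ∘ exchange) (Q j) ++ b ∷ []               ≡⟨ cong (_++ b ∷ []) (map-∘ (Q j)) ⟩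
  map (letter a b) (map exchange (Q j)) ++ b ∷ []           ≡⟨ sym (map-++ (letter a b) (map exchange (Q j)) (B ∷ [])) ⟩
  map (letter a b) (map exchange (Q j) ++ B ∷ [])           ∎))
  where open ≡-Reasoning
fibLyndon-letters (_ , _ , _ , 1 , s≤s () , _)
fibLyndon-letters (_ , _ , _ , 2 , s≤s (s≤s ()) , _)

fibLyndon-covered : IsFibLyndon w → ∃ λ j → length w ≡ fib (3 + j) × Covered w (3 + j)
fibLyndon-covered fl with fibLyndon-letters fl
... | a , b , a<b , j , inj₁ refl = j , trans (length-map _ (G j)) (length-G j) , letter-covered a<b (proj₁ (GH-covered j))
... | a , b , a<b , j , inj₂ refl = j , trans (length-map _ (H j)) (length-H j) , letter-covered a<b (proj₂ (GH-covered j))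

corollary13 : ∀ {m} (w : Word m) → Lyndon w
    → (k : ℕ) → IsCeilLogPhi (length w) k
    → (N : ℕ) → NumLyndonFactors w N
    → (k + 1 ≤ N) × (IsFibLyndon w → N ≡ k + 1)
corollary13 w lw k ceil N nf = lowerBound lw ceil nf , equality
  where
  equality : IsFibLyndon w → N ≡ k + 1
  equality fl with j , |w|≡F , covered ← fibLyndon-covered fl =
    ≤-antisym (≤-trans (numLyndonFactors-≤ nf covered) 3+j≤k+1) (lowerBound lw ceil nf)
    where
    3+j≤k+1 : 3 + j ≤ k + 1
    3+j≤k+1 = subst (3 + j ≤_) (+-comm 1 k) (s≤s (ceilLogPhi-fib (subst (λ n → IsCeilLogPhi n k) |w|≡F ceil)))
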